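{- Let $a,b$ be integers with $0<a<b$ and $\gcd(a,b)=1$. Write $\frac{a}{b}=[0,a_1,\ldots,a_n]$ as a regular continued fraction with all partial quotients $a_1,\ldots,a_n$ positive integers and with $n$ odd. Let $a^*$ be the integer with $0<a^*<b$ and $aa^*\equiv 1 \pmod b$, and let $k$ be the positive integer with $aa^*=1+kb$. Let $D(a,b)=\sum_{j=1}^n a_j$. If $a$ or $a^*$ is odd, then $D(a,b)\equiv b-k \pmod 2$.
   Context: The requirement that $n$ be odd (rather than $a_n\ge 2$) makes the expansion unique: if the usual expansion has even length with last quotient $a_n\ge2$, one uses $[0,a_1,\ldots,a_n-1,1]$; if it has even length with $a_n=1$, one uses $[0,a_1,\ldots,a_{n-1}+1]$. -}

module Defs where

open import Data.Nat using (ℕ; zero; suc; _+_; _*_)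
open import Data.List using (List; []; _∷_)
open import Data.Product using (_×_; _,_)

-- value of the finite continued fraction [x₀; x₁, …, xₘ] (nonempty list,
-- all entries positive) as a pair (numerator , denominator), i.e.
-- [x₀; x₁, …] = x₀ + 1 / [x₁; …].  For the empty list we return (0 , 1)
-- (never used in the statement, since n is odd).
cfFrac : List ℕ → ℕ × ℕ
cfFrac [] = 0 , 1
cfFrac (x ∷ []) = x , 1
cfFrac (x ∷ xs@(_ ∷ _)) with cfFrac xs
... | p , q = x * p + q , p

cf0Frac : List ℕ → ℕ × ℕ
cf0Frac xs with cfFrac xs
... | p , q = q , p

-- Writing M(x) = [[x,1],[1,0]], the product M(a₁)⋯M(aₙ) has first column (b, a), as
-- b/a = [a₁;…,aₙ], and determinant −1 because n is odd; so its second column is (a*, k), the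
-- inverse of a modulo b and the matching quotient. Modulo 2 the product lies in
-- GL₂(𝔽₂) ≅ S₃, where M(x) is a transposition for even x and a 3-cycle for odd x, so
-- Σ (aⱼ + 1) ≡ D(a,b) + 1 is the sign of the reduced product. If a or a* is odd, that product is
-- not the identity, and a non-identity element of GL₂(𝔽₂) is odd exactly when its trace b + k
-- vanishes; hence D(a,b) ≡ b + k.
{-# OPTIONS --safe #-}
module Submission where

open import Defs
open import Data.Nat using (ℕ; zero; suc; _+_; _*_; _∸_; _<_; _≤_; _%_; z≤n; >-nonZero; parity)
open import Data.Nat.Properties
open import Data.Nat.Divisibility
open import Data.Nat.Coprimality using (Coprime; coprime-divisor; gcd≡1⇒coprime)
import Data.Nat.Coprimality as Coprimality
open import Data.Nat.GCD using (gcd)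
open import Data.Nat.Solver using (module +-*-Solver)
open import Data.Parity.Base using (Parity; 0ℙ; 1ℙ; _⁻¹) renaming (_+_ to infixl 6 _⊕_; _*_ to infixl 7 _·_)
import Data.Parity.Properties as ℙ
open import Data.List using (List; []; _∷_; length; foldr)
open import Data.Nat.ListAction using (sum)
open import Data.List.Relation.Unary.All using (All; []; _∷_)
open import Data.Product using (_×_; _,_; proj₁; proj₂)
open import Data.Sum using (_⊎_; inj₁; inj₂) renaming (map to ⊎-map)
open import Relation.Nullary using (contradiction)
open import Relation.Binary.PropositionalEquality

-- The matrix [[p,p′],[q,q′]].
record Mat : Set where
  constructor mkMat
  field p p′ q q′ : ℕ
open Mat

identity : Mat
identity = mkMat 1 0 0 1

-- Left multiplication by [[x,1],[1,0]].
push : ℕ → Mat → Mat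
push x (mkMat P P′ Q Q′) = mkMat (x * P + Q) (x * P′ + Q′) P P′

cfMatrix : List ℕ → Mat
cfMatrix = foldr push identity

cfFrac-cfMatrix : ∀ x xs → cfFrac (x ∷ xs) ≡ (p (cfMatrix (x ∷ xs)) , q (cfMatrix (x ∷ xs)))
cfFrac-cfMatrix x [] = cong (_, 1) (sym (trans (+-identityʳ (x * 1)) (*-identityʳ x)))
cfFrac-cfMatrix x (y ∷ ys) with cfFrac (y ∷ ys) | cfFrac-cfMatrix y ys
... | _ | refl = refl

cf0Frac-cfMatrix : ∀ x xs → cf0Frac (x ∷ xs) ≡ (q (cfMatrix (x ∷ xs)) , p (cfMatrix (x ∷ xs)))
cf0Frac-cfMatrix x xs with cfFrac (x ∷ xs) | cfFrac-cfMatrix x xs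
... | _ | refl = refl

cfMatrix-p′≤p×q′≤q : ∀ x xs → All (0 <_) (x ∷ xs) →
                     p′ (cfMatrix (x ∷ xs)) ≤ p (cfMatrix (x ∷ xs)) × q′ (cfMatrix (x ∷ xs)) ≤ q (cfMatrix (x ∷ xs))
cfMatrix-p′≤p×q′≤q x [] (0<x ∷ _) rewrite *-zeroʳ x | *-identityʳ x | +-identityʳ x = 0<x , z≤n
cfMatrix-p′≤p×q′≤q x (y ∷ ys) (_ ∷ pos) with cfMatrix-p′≤p×q′≤q y ys pos
... | p′≤p , q′≤q = +-mono-≤ (*-monoʳ-≤ x p′≤p) q′≤q , p′≤p

-- The determinant p q′ − p′ q equals d − c (stated without truncated subtraction).
Det : ℕ → ℕ → Mat → Set
Det c d m = c + p m * q′ m ≡ d + p′ m * q m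

push-det : ∀ {c d} x m → Det c d m → Det d c (push x m)
push-det {c} {d} x (mkMat P P′ Q Q′) det = begin
  d + (x * P + Q) * P′       ≡⟨ solve 6 (λ d x P P′ Q Q′ → d :+ (x :* P :+ Q) :* P′ := x :* P :* P′ :+ (d :+ P′ :* Q)) refl d x P P′ Q Q′ ⟩
  x * P * P′ + (d + P′ * Q)  ≡⟨ cong (x * P * P′ +_) (sym det) ⟩
  x * P * P′ + (c + P * Q′)  ≡⟨ solve 6 (λ c x P P′ Q Q′ → x :* P :* P′ :+ (c :+ P :* Q′) := c :+ (x :* P′ :+ Q′) :* P) refl c x P P′ Q Q′ ⟩
  c + (x * P′ + Q′) * P      ∎
  where open ≡-Reasoning
        open +-*-Solver

Unimodular : Mat → Set
Unimodular m = Det 0 1 m ⊎ Det 1 0 m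

cfMatrix-unimodular : ∀ xs → Unimodular (cfMatrix xs)
cfMatrix-unimodular [] = inj₁ refl
cfMatrix-unimodular (x ∷ xs) with cfMatrix-unimodular xs
... | inj₁ det = inj₂ (push-det x (cfMatrix xs) det)
... | inj₂ det = inj₁ (push-det x (cfMatrix xs) det)

cfMatrix-det-odd : ∀ xs → length xs % 2 ≡ 1 → Det 1 0 (cfMatrix xs)
cfMatrix-det-odd (x ∷ []) _ = push-det x identity refl
cfMatrix-det-odd (x ∷ y ∷ xs) odd =
  push-det x (cfMatrix (y ∷ xs)) (push-det y (cfMatrix xs) (cfMatrix-det-odd xs odd))

det⇒inverse : ∀ {m} → Det 1 0 m → q m * p′ m ≡ 1 + q′ m * p m
det⇒inverse {mkMat P P′ Q Q′} det = trans (*-comm Q P′) (trans (sym det) (cong suc (*-comm P Q′)))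

∣suc∧∣⇒∣1 : ∀ {d n} → d ∣ suc n → d ∣ n → d ∣ 1
∣suc∧∣⇒∣1 {d} {n} d∣1+n = ∣m+n∣m⇒∣n (subst (d ∣_) (+-comm 1 n) d∣1+n)

unimodular⇒coprime : ∀ m → Unimodular m → Coprime (q m) (p m)
unimodular⇒coprime (mkMat P P′ Q Q′) (inj₁ det) {d} (d∣Q , d∣P) =
  ∣1⇒≡1 (∣suc∧∣⇒∣1 (subst (d ∣_) det (∣m⇒∣m*n Q′ d∣P)) (∣n⇒∣m*n P′ d∣Q))
unimodular⇒coprime (mkMat P P′ Q Q′) (inj₂ det) {d} (d∣Q , d∣P) =
  ∣1⇒≡1 (∣suc∧∣⇒∣1 (subst (d ∣_) (sym det) (∣n⇒∣m*n P′ d∣Q)) (∣m⇒∣m*n Q′ d∣P))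

reduced-fraction-unique : ∀ {a b c d} → 0 < a → Coprime a b → Coprime c d →
                          a * d ≡ b * c → a ≡ c × b ≡ d
reduced-fraction-unique {a} {b} {c} {d} 0<a cop-ab cop-cd ad≡bc = a≡c , b≡d
  where
  a≡c : a ≡ c
  a≡c = ∣-antisym (coprime-divisor cop-ab (subst (a ∣_) ad≡bc (m∣m*n d)))
                  (coprime-divisor cop-cd (subst (c ∣_) (trans (sym ad≡bc) (*-comm a d)) (n∣m*n b)))
  b≡d : b ≡ d
  b≡d = *-cancelʳ-≡ b d a {{>-nonZero 0<a}}
          (sym (trans (*-comm d a) (trans ad≡bc (cong (b *_) (sym a≡c)))))

cfMatrix-fraction : ∀ {a b} x xs → 0 < a → Coprime a b →
                    a * proj₂ (cf0Frac (x ∷ xs)) ≡ b * proj₁ (cf0Frac (x ∷ xs)) →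
                    a ≡ q (cfMatrix (x ∷ xs)) × b ≡ p (cfMatrix (x ∷ xs))
cfMatrix-fraction {a} {b} x xs 0<a cop a/b≡cf =
  reduced-fraction-unique 0<a cop (unimodular⇒coprime (cfMatrix (x ∷ xs)) (cfMatrix-unimodular (x ∷ xs)))
    (subst (λ r → a * proj₂ r ≡ b * proj₁ r) (cf0Frac-cfMatrix x xs) a/b≡cf)

∣∧<⇒≡0 : ∀ {b n} → b ∣ n → n < b → n ≡ 0
∣∧<⇒≡0 {n = zero}  _   _   = refl
∣∧<⇒≡0 {n = suc _} b∣n n<b = contradiction b∣n (>⇒∤ n<b)

mod-inverse-unique : ∀ {a b x y u v} → Coprime a b →
                     a * x ≡ 1 + u * b → a * y ≡ 1 + v * b → x < b → y < b → x ≡ y × u ≡ v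
mod-inverse-unique {a} {b} {x} {y} {u} {v} cop ax≡ ay≡ x<b y<b = x≡y , u≡v
  where
  b∣a[m∸n] : ∀ {m n} s t → a * m ≡ 1 + s * b → a * n ≡ 1 + t * b → b ∣ a * (m ∸ n)
  b∣a[m∸n] {m} {n} s t am≡ an≡ = divides (s ∸ t) (begin
    a * (m ∸ n)                ≡⟨ *-distribˡ-∸ a m n ⟩
    a * m ∸ a * n              ≡⟨ cong₂ _∸_ am≡ an≡ ⟩
    (1 + s * b) ∸ (1 + t * b)  ≡⟨ *-distribʳ-∸ b s t ⟨
    (s ∸ t) * b                ∎)
    where open ≡-Reasoning
  m∸n≡0 : ∀ m n s t → a * m ≡ 1 + s * b → a * n ≡ 1 + t * b → m < b → m ∸ n ≡ 0
  m∸n≡0 m n s t am≡ an≡ m<b =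
    ∣∧<⇒≡0 (coprime-divisor (Coprimality.sym cop) (b∣a[m∸n] s t am≡ an≡)) (≤-<-trans (m∸n≤m m n) m<b)
  x≡y : x ≡ y
  x≡y = ≤-antisym (m∸n≡0⇒m≤n (m∸n≡0 x y u v ax≡ ay≡ x<b)) (m∸n≡0⇒m≤n (m∸n≡0 y x v u ay≡ ax≡ y<b))
  u≡v : u ≡ v
  u≡v = *-cancelʳ-≡ u v b {{>-nonZero (≤-<-trans z≤n y<b)}}
          (suc-injective (trans (sym ax≡) (trans (cong (a *_) x≡y) ay≡)))

mod-inverse-< : ∀ {a b x u} → 1 < b → a * x ≡ 1 + u * b → x ≤ b → x < b
mod-inverse-< {a} {b} {x} {u} 1<b ax≡ x≤b = ≤∧≢⇒< x≤b x≢b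
  where
  x≢b : x ≢ b
  x≢b refl = <⇒≢ 1<b (sym (∣1⇒≡1 (∣suc∧∣⇒∣1 (subst (b ∣_) ax≡ (n∣m*n a)) (n∣m*n u))))

parity-suc : ∀ n → parity (suc n) ≡ parity n ⁻¹
parity-suc n = trans (sym (ℙ.⁻¹-involutive (parity (suc n)))) (cong _⁻¹ (ℙ.suc-homo-⁻¹ n))

parity-%2 : ∀ m n → parity m ≡ parity n → m % 2 ≡ n % 2
parity-%2 0             0             _ = refl
parity-%2 1             1             _ = refl
parity-%2 (suc (suc m)) n             h = parity-%2 m n h
parity-%2 0             (suc (suc n)) h = parity-%2 0 n h
parity-%2 1             (suc (suc n)) h = parity-%2 1 n h

%2≡1⇒parity≡1ℙ : ∀ n → n % 2 ≡ 1 → parity n ≡ 1ℙ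
%2≡1⇒parity≡1ℙ 1             _ = refl
%2≡1⇒parity≡1ℙ (suc (suc n)) h = %2≡1⇒parity≡1ℙ n h

-- An invertible matrix [[p,p′],[q,q′]] over 𝔽₂ permutes the three nonzero vectors of 𝔽₂²;
-- the odd permutations are exactly the elements of trace 0 other than the identity.
sign₂ : Parity → Parity → Parity → Parity → Parity
sign₂ p p′ q q′ = (p ⊕ q′) ⁻¹ · (p′ ⁻¹ · q ⁻¹) ⁻¹

sign₂-push : ∀ x p p′ q q′ → p · q′ ⊕ p′ · q ≡ 1ℙ →
             sign₂ (x · p ⊕ q) (x · p′ ⊕ q′) p p′ ≡ x ⁻¹ ⊕ sign₂ p p′ q q′
sign₂-push 0ℙ 0ℙ 0ℙ 0ℙ 0ℙ ()
sign₂-push 0ℙ 0ℙ 0ℙ 0ℙ 1ℙ ()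
sign₂-push 0ℙ 0ℙ 0ℙ 1ℙ 0ℙ ()
sign₂-push 0ℙ 0ℙ 0ℙ 1ℙ 1ℙ ()
sign₂-push 0ℙ 0ℙ 1ℙ 0ℙ 0ℙ ()
sign₂-push 0ℙ 0ℙ 1ℙ 0ℙ 1ℙ ()
sign₂-push 0ℙ 0ℙ 1ℙ 1ℙ 0ℙ _ = refl
sign₂-push 0ℙ 0ℙ 1ℙ 1ℙ 1ℙ _ = refl
sign₂-push 0ℙ 1ℙ 0ℙ 0ℙ 0ℙ ()
sign₂-push 0ℙ 1ℙ 0ℙ 0ℙ 1ℙ _ = refl
sign₂-push 0ℙ 1ℙ 0ℙ 1ℙ 0ℙ ()
sign₂-push 0ℙ 1ℙ 0ℙ 1ℙ 1ℙ _ = refl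
sign₂-push 0ℙ 1ℙ 1ℙ 0ℙ 0ℙ ()
sign₂-push 0ℙ 1ℙ 1ℙ 0ℙ 1ℙ _ = refl
sign₂-push 0ℙ 1ℙ 1ℙ 1ℙ 0ℙ _ = refl
sign₂-push 0ℙ 1ℙ 1ℙ 1ℙ 1ℙ ()
sign₂-push 1ℙ 0ℙ 0ℙ 0ℙ 0ℙ ()
sign₂-push 1ℙ 0ℙ 0ℙ 0ℙ 1ℙ ()
sign₂-push 1ℙ 0ℙ 0ℙ 1ℙ 0ℙ ()
sign₂-push 1ℙ 0ℙ 0ℙ 1ℙ 1ℙ ()
sign₂-push 1ℙ 0ℙ 1ℙ 0ℙ 0ℙ ()
sign₂-push 1ℙ 0ℙ 1ℙ 0ℙ 1ℙ ()
sign₂-push 1ℙ 0ℙ 1ℙ 1ℙ 0ℙ _ = refl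
sign₂-push 1ℙ 0ℙ 1ℙ 1ℙ 1ℙ _ = refl
sign₂-push 1ℙ 1ℙ 0ℙ 0ℙ 0ℙ ()
sign₂-push 1ℙ 1ℙ 0ℙ 0ℙ 1ℙ _ = refl
sign₂-push 1ℙ 1ℙ 0ℙ 1ℙ 0ℙ ()
sign₂-push 1ℙ 1ℙ 0ℙ 1ℙ 1ℙ _ = refl
sign₂-push 1ℙ 1ℙ 1ℙ 0ℙ 0ℙ ()
sign₂-push 1ℙ 1ℙ 1ℙ 0ℙ 1ℙ _ = refl
sign₂-push 1ℙ 1ℙ 1ℙ 1ℙ 0ℙ _ = refl
sign₂-push 1ℙ 1ℙ 1ℙ 1ℙ 1ℙ ()

sign₂-nonidentity : ∀ p p′ q q′ → q ≡ 1ℙ ⊎ p′ ≡ 1ℙ → sign₂ p p′ q q′ ≡ (p ⊕ q′) ⁻¹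
sign₂-nonidentity p p′ q q′ (inj₁ refl) rewrite ℙ.*-zeroʳ (p′ ⁻¹) = ℙ.*-identityʳ ((p ⊕ q′) ⁻¹)
sign₂-nonidentity p p′ q q′ (inj₂ refl) = ℙ.*-identityʳ ((p ⊕ q′) ⁻¹)

sign : Mat → Parity
sign m = sign₂ (parity (p m)) (parity (p′ m)) (parity (q m)) (parity (q′ m))

unimodular-mod2 : ∀ m → Unimodular m →
                  parity (p m) · parity (q′ m) ⊕ parity (p′ m) · parity (q m) ≡ 1ℙ
unimodular-mod2 (mkMat P P′ Q Q′) (inj₁ det) = begin
  parity P · parity Q′ ⊕ parity P′ · parity Q  ≡⟨ cong₂ _⊕_ (ℙ.*-homo-* P Q′) (ℙ.*-homo-* P′ Q) ⟨
  parity (P * Q′) ⊕ parity (P′ * Q)            ≡⟨ cong (_⊕ parity (P′ * Q)) (trans (cong parity det) (parity-suc (P′ * Q))) ⟩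
  parity (P′ * Q) ⁻¹ ⊕ parity (P′ * Q)         ≡⟨ ℙ.p⁻¹+p≡1ℙ (parity (P′ * Q)) ⟩
  1ℙ                                           ∎
  where open ≡-Reasoning
unimodular-mod2 (mkMat P P′ Q Q′) (inj₂ det) = begin
  parity P · parity Q′ ⊕ parity P′ · parity Q  ≡⟨ cong₂ _⊕_ (ℙ.*-homo-* P Q′) (ℙ.*-homo-* P′ Q) ⟨
  parity (P * Q′) ⊕ parity (P′ * Q)            ≡⟨ cong (parity (P * Q′) ⊕_) (trans (cong parity (sym det)) (parity-suc (P * Q′))) ⟩
  parity (P * Q′) ⊕ parity (P * Q′) ⁻¹         ≡⟨ ℙ.p+p⁻¹≡1ℙ (parity (P * Q′)) ⟩
  1ℙ                                           ∎
  where open ≡-Reasoning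

parity-linear : ∀ x y z → parity (x * y + z) ≡ parity x · parity y ⊕ parity z
parity-linear x y z = trans (ℙ.+-homo-+ (x * y) z) (cong (_⊕ parity z) (ℙ.*-homo-* x y))

sign-push : ∀ x m → Unimodular m → sign (push x m) ≡ parity x ⁻¹ ⊕ sign m
sign-push x m@(mkMat P P′ Q Q′) unimodular
  rewrite parity-linear x P Q | parity-linear x P′ Q′ =
  sign₂-push (parity x) (parity P) (parity P′) (parity Q) (parity Q′) (unimodular-mod2 m unimodular)

cfMatrix-sign : ∀ xs → parity (sum xs + length xs) ≡ sign (cfMatrix xs)
cfMatrix-sign []       = refl
cfMatrix-sign (x ∷ xs) = begin
  parity (x + sum xs + suc (length xs))        ≡⟨ cong parity (trans (+-suc (x + sum xs) (length xs)) (cong suc (+-assoc x (sum xs) (length xs)))) ⟩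
  parity (suc x + (sum xs + length xs))        ≡⟨ ℙ.+-homo-+ (suc x) (sum xs + length xs) ⟩
  parity (suc x) ⊕ parity (sum xs + length xs) ≡⟨ cong₂ _⊕_ (parity-suc x) (cfMatrix-sign xs) ⟩
  parity x ⁻¹ ⊕ sign (cfMatrix xs)             ≡⟨ sign-push x (cfMatrix xs) (cfMatrix-unimodular xs) ⟨
  sign (cfMatrix (x ∷ xs))                     ∎
  where open ≡-Reasoning

parity-sum-odd-length : ∀ xs → length xs % 2 ≡ 1 → parity (sum xs) ≡ sign (cfMatrix xs) ⁻¹
parity-sum-odd-length xs odd = begin
  parity (sum xs)                    ≡⟨ ℙ.⁻¹-involutive (parity (sum xs)) ⟨
  (1ℙ ⊕ parity (sum xs)) ⁻¹          ≡⟨ cong _⁻¹ (ℙ.+-comm 1ℙ (parity (sum xs))) ⟩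
  (parity (sum xs) ⊕ 1ℙ) ⁻¹          ≡⟨ cong (λ l → (parity (sum xs) ⊕ l) ⁻¹) (%2≡1⇒parity≡1ℙ (length xs) odd) ⟨
  (parity (sum xs) ⊕ parity (length xs)) ⁻¹
                                     ≡⟨ cong _⁻¹ (trans (sym (ℙ.+-homo-+ (sum xs) (length xs))) (cfMatrix-sign xs)) ⟩
  sign (cfMatrix xs) ⁻¹              ∎
  where open ≡-Reasoning

cfMatrix-parity : ∀ xs → length xs % 2 ≡ 1 →
                  parity (q (cfMatrix xs)) ≡ 1ℙ ⊎ parity (p′ (cfMatrix xs)) ≡ 1ℙ →
                  parity (sum xs + q′ (cfMatrix xs)) ≡ parity (p (cfMatrix xs))
cfMatrix-parity xs odd q-or-p′-odd = begin
  parity (sum xs + q′ m)        ≡⟨ ℙ.+-homo-+ (sum xs) (q′ m) ⟩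
  parity (sum xs) ⊕ q̄′          ≡⟨ cong (_⊕ q̄′) (parity-sum-odd-length xs odd) ⟩
  sign m ⁻¹ ⊕ q̄′                ≡⟨ cong (λ s → s ⁻¹ ⊕ q̄′) (sign₂-nonidentity p̄ _ _ q̄′ q-or-p′-odd) ⟩
  (p̄ ⊕ q̄′) ⁻¹ ⁻¹ ⊕ q̄′           ≡⟨ cong (_⊕ q̄′) (ℙ.⁻¹-involutive (p̄ ⊕ q̄′)) ⟩
  p̄ ⊕ q̄′ ⊕ q̄′                   ≡⟨ ℙ.+-assoc p̄ q̄′ q̄′ ⟩
  p̄ ⊕ (q̄′ ⊕ q̄′)                 ≡⟨ cong (p̄ ⊕_) (ℙ.p+p≡0ℙ q̄′) ⟩
  p̄ ⊕ 0ℙ                        ≡⟨ ℙ.+-identityʳ p̄ ⟩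
  p̄                             ∎
  where
  open ≡-Reasoning
  m = cfMatrix xs
  p̄ = parity (p m)
  q̄′ = parity (q′ m)

corollary2 : (a b : ℕ) → 0 < a → a < b → gcd a b ≡ 1 →
    (as : List ℕ) → All (0 <_) as → length as % 2 ≡ 1 →
    a * proj₂ (cf0Frac as) ≡ b * proj₁ (cf0Frac as) →
    (a* k : ℕ) → 0 < a* → a* < b → 0 < k → a * a* ≡ 1 + k * b →
    a % 2 ≡ 1 ⊎ a* % 2 ≡ 1 →
    (sum as + k) % 2 ≡ b % 2
corollary2 a b 0<a a<b gcd≡1 (x ∷ xs) pos odd a/b≡cf a* k _ a*<b _ aa*≡1+kb a-or-a*-odd
  with cfMatrix-fraction x xs 0<a (gcd≡1⇒coprime gcd≡1) a/b≡cf
... | refl , refl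
  with mod-inverse-unique {q m} {u = k} {v = q′ m} (gcd≡1⇒coprime gcd≡1) aa*≡1+kb inverse a*<b
         (mod-inverse-< {q m} {u = q′ m} (≤-<-trans 0<a a<b) inverse (proj₁ (cfMatrix-p′≤p×q′≤q x xs pos)))
  where
  m = cfMatrix (x ∷ xs)
  inverse : q m * p′ m ≡ 1 + q′ m * p m
  inverse = det⇒inverse {m} (cfMatrix-det-odd (x ∷ xs) odd)
... | refl , refl = parity-%2 (sum (x ∷ xs) + q′ m) (p m)
  (cfMatrix-parity (x ∷ xs) odd (⊎-map (%2≡1⇒parity≡1ℙ (q m)) (%2≡1⇒parity≡1ℙ (p′ m)) a-or-a*-odd))
  where m = cfMatrix (x ∷ xs)
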